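{- Let $n$ be a positive integer. There exists an antipodal $3$-design with $n$ rational points for the Hermite measure $e^{ -t^2}dt/\sqrt{\pi}$ on $(-\infty,\infty)$ if and only if $n \notin \{1,2,3,7\}$.
   Context: Let $I\subseteq\mathbb{R}$ be an interval and $w$ a probability density on $I$ with finite moments. An $m$-design with $n$ points for the measure $w(t)\,dt$ on $I$ is a collection of $n$ pairwise distinct points $x_1,\dots,x_n\in I$ such that $\frac{1}{n}\sum_{i=1}^n f(x_i)=\int_I f(t)w(t)\,dt$ for every real polynomial $f$ of degree at most $m$. It is rational if all $x_i\in\mathbb{Q}$, and antipodal if the set $\{x_1,\dots,x_n\}$ coincides with $\{ -x_1,\dots,-x_n\}$. The Hermite measure is $w(t)=e^{ -t^2}/\sqrt{\pi}$ on $I=(-\infty,\infty)$. -}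

module Defs where

open import Data.Nat using (ℕ)
open import Data.Integer using (+_)
open import Data.Rational using (ℚ; 0ℚ; 1ℚ; ½; _+_; _*_; _/_; -_)
open import Data.Fin using (Fin; zero; suc)
open import Data.Vec using (Vec; _∷_; [])
open import Data.List using (List; map; length; foldr)
open import Data.List.Membership.Propositional using (_∈_)
open import Data.List.Relation.Unary.Unique.Propositional using (Unique)
open import Data.Product using (_×_)
open import Relation.Binary.PropositionalEquality using (_≡_)

-- A real polynomial of degree at most 3, with rational coefficients
-- (coefficients a₀ a₁ a₂ a₃ of 1, t, t², t³).
Poly3 : Set
Poly3 = Vec ℚ 4

evalPoly3 : Poly3 → ℚ → ℚ
evalPoly3 (a₀ ∷ a₁ ∷ a₂ ∷ a₃ ∷ []) x = a₀ + x * (a₁ + x * (a₂ + x * a₃))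

-- Moments ∫ tᵏ e^{-t²}/√π dt for k = 0,1,2,3 of the Hermite measure:
-- 1, 0, 1/2, 0.
hermiteMoment : Fin 4 → ℚ
hermiteMoment zero = 1ℚ
hermiteMoment (suc zero) = 0ℚ
hermiteMoment (suc (suc zero)) = ½
hermiteMoment (suc (suc (suc zero))) = 0ℚ

hermiteIntegral : Poly3 → ℚ
hermiteIntegral (a₀ ∷ a₁ ∷ a₂ ∷ a₃ ∷ []) =
  a₀ * hermiteMoment zero + a₁ * hermiteMoment (suc zero)
  + a₂ * hermiteMoment (suc (suc zero)) + a₃ * hermiteMoment (suc (suc (suc zero)))

sumℚ : List ℚ → ℚ
sumℚ = foldr _+_ 0ℚ

-- xs is a 3-design with n points for the Hermite measure:
-- n pairwise distinct points with (1/n) Σ f(xᵢ) = ∫ f w for all f of degree ≤ 3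
-- (stated multiplied through by n, n ≥ 1).
IsHermite3Design : ℕ → List ℚ → Set
IsHermite3Design n xs =
  length xs ≡ n × Unique xs ×
  ((f : Poly3) → sumℚ (map (evalPoly3 f) xs) ≡ (+ n / 1) * hermiteIntegral f)

IsAntipodal : List ℚ → Set
IsAntipodal xs = ((x : ℚ) → x ∈ xs → (- x) ∈ xs) × ((x : ℚ) → (- x) ∈ xs → x ∈ xs)

{-# OPTIONS --safe #-}

-- An antipodal set of n distinct points is {±y : y ∈ Y}, plus 0 when n is odd, for a set Y
-- of positive rationals. The odd moments of such a set vanish, so it is a 3-design exactly
-- when its second moment is right, i.e. when 4 Σ_{y ∈ Y} y² = n.
--
-- Existence: q points (a, b) with a² + b² = 1 on the unit circle, taken from the Pythagorean
-- triples (m² − 1, 2m, m² + 1), contribute 2q points to Y and 4q to n; adding a fixed core of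
-- 0, 2, 3 or 5 values lying strictly between all the a's and all the b's gives every
-- n = 4q, 4q + 5, 4q + 6, 4q + 11, which are exactly the n ∉ {1, 2, 3, 7}.
--
-- Non-existence: for n = 1, 2, 3, 7 the condition reads 0 = 1, (2y)² = 2, (2y)² = 3 or
-- (2y₁)² + (2y₂)² + (2y₃)² = 7. Adding 1² + 2², resp. 2² + 0², to the middle two, each case
-- would write 7 as a sum of three rational squares. Clearing denominators gives
-- x² + y² + z² = 7w² in ℕ; as squares are 0, 1 or 4 mod 8, w odd is impossible and w even
-- forces x, y, z even, so w = 0 by descent.

module Submission where

open import Defs
open import Data.Nat using (ℕ; _≤_)
open import Data.Rational using (ℚ)
open import Data.List using (List)
open import Data.Product using (Σ; _×_)
open import Data.Sum using (_⊎_)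
open import Relation.Nullary using (¬_)
open import Function.Bundles using (_⇔_; mk⇔)
open import Relation.Binary.PropositionalEquality using (_≡_)

open import Algebra.Properties.Group using (⁻¹-involutive)
open import Data.Bool.Base using (Bool; true; false)
open import Data.Empty using (⊥; ⊥-elim)
open import Data.Integer.Base as ℤ using (+_; ∣_∣)
import Data.Integer.Properties as ℤ
import Data.Integer.Tactic.RingSolver as ℤ-Ring
open import Data.List.Base using ([]; _∷_; [_]; _++_; map; length; applyUpTo)
open import Data.List.Membership.Propositional using (_∈_)
open import Data.List.Membership.Propositional.Properties using (∈-∃++)
open import Data.List.Properties using (length-++; length-applyUpTo)
open import Data.List.Relation.Binary.Disjoint.Propositional using (Disjoint)
open import Data.List.Relation.Binary.Permutation.Propositional
  using (_↭_; refl; prep; swap; trans; ↭-sym; ↭⇒↭ₛ)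
open import Data.List.Relation.Binary.Permutation.Propositional.Properties
  using (↭-length; ∈-resp-↭; shift; map⁺)
open import Data.List.Relation.Binary.Permutation.Setoid.Properties
  using (foldr-commMonoid; Unique-resp-↭)
open import Data.List.Relation.Unary.All as All using (All; []; _∷_; all?)
import Data.List.Relation.Unary.All.Properties as All
open import Data.List.Relation.Unary.AllPairs as AllPairs using ([]; _∷_)
open import Data.List.Relation.Unary.Any using (here; there)
open import Data.List.Relation.Unary.Unique.DecPropositional using (unique?)
open import Data.List.Relation.Unary.Unique.Propositional using (Unique)
import Data.List.Relation.Unary.Unique.Propositional.Properties as Unique
open import Data.Nat.Base as ℕ using (zero; suc; z≤n; s≤s; z<s)
open import Data.Nat.DivMod using (_%_; [m+kn]%n≡m%n; m<n⇒m%n≡m)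
open import Data.Nat.Induction using (<-wellFounded; <-rec)
import Data.Nat.Properties as ℕ
import Data.Nat.Tactic.RingSolver as ℕ-Ring
open import Data.Product using (∃; ∃₂; _,_)
open import Data.Rational.Base using (0ℚ; 1ℚ; ½; _+_; _*_; -_; _/_; _<_; toℚᵘ; ↥_; ↧_)
open import Data.Rational.Properties
  using ( _≟_; _<?_; <-trans; <-asym; <⇒≢; neg-antimono-<; neg-injective
        ; +-identityˡ; +-identityʳ; +-assoc; +-inverseʳ; *-distribʳ-+
        ; +-0-group; +-0-isCommutativeMonoid
        ; toℚᵘ-injective; toℚᵘ-cong; toℚᵘ-fromℚᵘ; toℚᵘ-homo-+; toℚᵘ-homo-*; toℚᵘ-homo‿-
        ; toℚᵘ-cancel-<)
open import Data.Rational.Solver using (module +-*-Solver)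
import Data.Rational.Unnormalised.Base as ℚᵘ
import Data.Rational.Unnormalised.Properties as ℚᵘ
open import Data.Sum using (inj₁; inj₂)
open import Data.Vec.Base using (_∷_; [])
open import Function.Base using (id; _∘_)
open import Induction.WellFounded using (Acc; acc)
open import Relation.Binary.Definitions using (Transitive)
open import Relation.Binary.PropositionalEquality
  using (_≢_; refl; sym; cong; cong₂; subst; subst₂; setoid; ≢-sym; module ≡-Reasoning)
  renaming (trans to ≡-trans)
open import Relation.Nullary.Decidable using (Dec; yes; no; from-yes; from-no; _×-dec_; _⊎-dec_)

open +-*-Solver using (solve; _:=_; _:+_; _:*_; :-_; con)

neg-involutive : ∀ x → - (- x) ≡ x
neg-involutive = ⁻¹-involutive +-0-group

fromℕ : ℕ → ℚ
fromℕ n = + n / 1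

fromℕ-+ : ∀ m n → fromℕ (m ℕ.+ n) ≡ fromℕ m + fromℕ n
fromℕ-+ m n = toℚᵘ-injective (begin-equality
  toℚᵘ (fromℕ (m ℕ.+ n))                 ≃⟨ toℚᵘ-fromℕ (m ℕ.+ n) ⟩
  ℚᵘ.mkℚᵘ (+ (m ℕ.+ n)) 0                ≃⟨ ℚᵘ.*≡* numerators ⟩
  ℚᵘ.mkℚᵘ (+ m) 0 ℚᵘ.+ ℚᵘ.mkℚᵘ (+ n) 0   ≃⟨ ℚᵘ.+-cong (toℚᵘ-fromℕ m) (toℚᵘ-fromℕ n) ⟨
  toℚᵘ (fromℕ m) ℚᵘ.+ toℚᵘ (fromℕ n)     ≃⟨ toℚᵘ-homo-+ (fromℕ m) (fromℕ n) ⟨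
  toℚᵘ (fromℕ m + fromℕ n)               ∎)
  where
  open ℚᵘ.≤-Reasoning
  toℚᵘ-fromℕ : ∀ k → toℚᵘ (fromℕ k) ℚᵘ.≃ ℚᵘ.mkℚᵘ (+ k) 0
  toℚᵘ-fromℕ k = toℚᵘ-fromℚᵘ (ℚᵘ.mkℚᵘ (+ k) 0)
  numerators : + (m ℕ.+ n) ℤ.* + 1 ≡ (+ m ℤ.* + 1 ℤ.+ + n ℤ.* + 1) ℤ.* + 1
  numerators = cong (ℤ._* + 1) (≡-trans (ℤ.pos-+ m n)
    (sym (cong₂ ℤ._+_ (ℤ.*-identityʳ (+ m)) (ℤ.*-identityʳ (+ n)))))

fraction-< : ∀ p q d e → p ℕ.* suc e ℕ.< q ℕ.* suc d → + p / suc d < + q / suc e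
fraction-< p q d e lt = toℚᵘ-cancel-< (begin-strict
  toℚᵘ (+ p / suc d)  ≃⟨ toℚᵘ-fromℚᵘ (ℚᵘ.mkℚᵘ (+ p) d) ⟩
  ℚᵘ.mkℚᵘ (+ p) d     <⟨ ℚᵘ.*<* (subst₂ ℤ._<_ (ℤ.pos-* p (suc e)) (ℤ.pos-* q (suc d)) (ℤ.+<+ lt)) ⟩
  ℚᵘ.mkℚᵘ (+ q) e     ≃⟨ toℚᵘ-fromℚᵘ (ℚᵘ.mkℚᵘ (+ q) e) ⟨
  toℚᵘ (+ q / suc e)  ∎)
  where open ℚᵘ.≤-Reasoning

<-of-difference : ∀ {m n} k → m ℕ.+ suc k ≡ n → m ℕ.< n
<-of-difference {m} k refl = ℕ.m<m+n m z<s

sumOf : (ℚ → ℚ) → List ℚ → ℚ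
sumOf g xs = sumℚ (map g xs)

square cube : ℚ → ℚ
square x = x * x
cube x = x * x * x

sumOf-++ : ∀ g xs ys → sumOf g (xs ++ ys) ≡ sumOf g xs + sumOf g ys
sumOf-++ g []       ys = sym (+-identityˡ (sumOf g ys))
sumOf-++ g (x ∷ xs) ys = ≡-trans (cong (λ s → g x + s) (sumOf-++ g xs ys)) (sym (+-assoc (g x) _ _))

sumOf-↭ : ∀ g {xs ys} → xs ↭ ys → sumOf g xs ≡ sumOf g ys
sumOf-↭ g p = foldr-commMonoid (setoid ℚ) +-0-isCommutativeMonoid (↭⇒↭ₛ (map⁺ g p))

HasHermiteMoments : List ℚ → Set
HasHermiteMoments xs = (f : Poly3) → sumOf (evalPoly3 f) xs ≡ fromℕ (length xs) * hermiteIntegral f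

sumOf-evalPoly3 : ∀ a₀ a₁ a₂ a₃ xs →
  sumOf (evalPoly3 (a₀ ∷ a₁ ∷ a₂ ∷ a₃ ∷ [])) xs
    ≡ a₀ * fromℕ (length xs) + a₁ * sumOf id xs + a₂ * sumOf square xs + a₃ * sumOf cube xs
sumOf-evalPoly3 a₀ a₁ a₂ a₃ [] =
  solve 4 (λ a₀ a₁ a₂ a₃ → con 0ℚ := a₀ :* con 0ℚ :+ a₁ :* con 0ℚ :+ a₂ :* con 0ℚ :+ a₃ :* con 0ℚ)
    refl a₀ a₁ a₂ a₃
sumOf-evalPoly3 a₀ a₁ a₂ a₃ (x ∷ xs) = begin
  evalPoly3 f x + sumOf (evalPoly3 f) xs
    ≡⟨ cong (λ s → evalPoly3 f x + s) (sumOf-evalPoly3 a₀ a₁ a₂ a₃ xs) ⟩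
  evalPoly3 f x + (a₀ * k + a₁ * s₁ + a₂ * s₂ + a₃ * s₃)
    ≡⟨ solve 9 (λ a₀ a₁ a₂ a₃ x k s₁ s₂ s₃ →
         (a₀ :+ x :* (a₁ :+ x :* (a₂ :+ x :* a₃))) :+ (a₀ :* k :+ a₁ :* s₁ :+ a₂ :* s₂ :+ a₃ :* s₃)
           := a₀ :* (con 1ℚ :+ k) :+ a₁ :* (x :+ s₁) :+ a₂ :* (x :* x :+ s₂) :+ a₃ :* (x :* x :* x :+ s₃))
         refl a₀ a₁ a₂ a₃ x k s₁ s₂ s₃ ⟩
  a₀ * (1ℚ + k) + a₁ * (x + s₁) + a₂ * (square x + s₂) + a₃ * (cube x + s₃)
    ≡⟨ cong (λ n → a₀ * n + a₁ * (x + s₁) + a₂ * (square x + s₂) + a₃ * (cube x + s₃))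
         (sym (fromℕ-+ 1 (length xs))) ⟩
  a₀ * fromℕ (suc (length xs)) + a₁ * (x + s₁) + a₂ * (square x + s₂) + a₃ * (cube x + s₃) ∎
  where
  open ≡-Reasoning
  f = a₀ ∷ a₁ ∷ a₂ ∷ a₃ ∷ []
  k = fromℕ (length xs)
  s₁ = sumOf id xs
  s₂ = sumOf square xs
  s₃ = sumOf cube xs

power-sums⇒moments : ∀ {xs} → sumOf id xs ≡ 0ℚ → sumOf square xs ≡ fromℕ (length xs) * ½ →
  sumOf cube xs ≡ 0ℚ → HasHermiteMoments xs
power-sums⇒moments {xs} s₁ s₂ s₃ (a₀ ∷ a₁ ∷ a₂ ∷ a₃ ∷ []) = begin
  sumOf (evalPoly3 (a₀ ∷ a₁ ∷ a₂ ∷ a₃ ∷ [])) xs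
    ≡⟨ sumOf-evalPoly3 a₀ a₁ a₂ a₃ xs ⟩
  a₀ * k + a₁ * sumOf id xs + a₂ * sumOf square xs + a₃ * sumOf cube xs
    ≡⟨ cong₂ (λ u v → a₀ * k + a₁ * u + a₂ * v + a₃ * sumOf cube xs) s₁ s₂ ⟩
  a₀ * k + a₁ * 0ℚ + a₂ * (k * ½) + a₃ * sumOf cube xs
    ≡⟨ cong (λ w → a₀ * k + a₁ * 0ℚ + a₂ * (k * ½) + a₃ * w) s₃ ⟩
  a₀ * k + a₁ * 0ℚ + a₂ * (k * ½) + a₃ * 0ℚ
    ≡⟨ solve 5 (λ a₀ a₁ a₂ a₃ k →
         a₀ :* k :+ a₁ :* con 0ℚ :+ a₂ :* (k :* con ½) :+ a₃ :* con 0ℚ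
           := k :* (a₀ :* con 1ℚ :+ a₁ :* con 0ℚ :+ a₂ :* con ½ :+ a₃ :* con 0ℚ))
         refl a₀ a₁ a₂ a₃ k ⟩
  k * (a₀ * 1ℚ + a₁ * 0ℚ + a₂ * ½ + a₃ * 0ℚ) ∎
  where
  open ≡-Reasoning
  k = fromℕ (length xs)

moments-++ : ∀ {xs ys} → HasHermiteMoments xs → HasHermiteMoments ys → HasHermiteMoments (xs ++ ys)
moments-++ {xs} {ys} mx my f = begin
  sumOf (evalPoly3 f) (xs ++ ys)                    ≡⟨ sumOf-++ (evalPoly3 f) xs ys ⟩
  sumOf (evalPoly3 f) xs + sumOf (evalPoly3 f) ys   ≡⟨ cong₂ _+_ (mx f) (my f) ⟩
  fromℕ (length xs) * h + fromℕ (length ys) * h     ≡⟨ *-distribʳ-+ h (fromℕ (length xs)) (fromℕ (length ys)) ⟨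
  (fromℕ (length xs) + fromℕ (length ys)) * h       ≡⟨ cong (_* h) (fromℕ-+ (length xs) (length ys)) ⟨
  fromℕ (length xs ℕ.+ length ys) * h               ≡⟨ cong (λ n → fromℕ n * h) (length-++ xs) ⟨
  fromℕ (length (xs ++ ys)) * h                     ∎
  where
  open ≡-Reasoning
  h = hermiteIntegral f

second-moment : ∀ {n xs} → IsHermite3Design n xs → sumOf square xs ≡ fromℕ n * ½
second-moment {n} {xs} (_ , _ , moments) = begin
  sumOf square xs
    ≡⟨ solve 4 (λ k s₁ s₂ s₃ → s₂ := con 0ℚ :* k :+ con 0ℚ :* s₁ :+ con 1ℚ :* s₂ :+ con 0ℚ :* s₃)
         refl (fromℕ (length xs)) (sumOf id xs) (sumOf square xs) (sumOf cube xs) ⟩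
  0ℚ * fromℕ (length xs) + 0ℚ * sumOf id xs + 1ℚ * sumOf square xs + 0ℚ * sumOf cube xs
    ≡⟨ sumOf-evalPoly3 0ℚ 0ℚ 1ℚ 0ℚ xs ⟨
  sumOf (evalPoly3 (0ℚ ∷ 0ℚ ∷ 1ℚ ∷ 0ℚ ∷ [])) xs
    ≡⟨ moments (0ℚ ∷ 0ℚ ∷ 1ℚ ∷ 0ℚ ∷ []) ⟩
  fromℕ n * ½ ∎
  where open ≡-Reasoning

mirror : List ℚ → List ℚ
mirror []       = []
mirror (y ∷ ys) = y ∷ - y ∷ mirror ys

symmetric : Bool → List ℚ → List ℚ
symmetric false ys = mirror ys
symmetric true  ys = 0ℚ ∷ mirror ys

mirror-++ : ∀ xs ys → mirror (xs ++ ys) ≡ mirror xs ++ mirror ys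
mirror-++ []       ys = refl
mirror-++ (x ∷ xs) ys = cong (λ zs → x ∷ - x ∷ zs) (mirror-++ xs ys)

symmetric-++ : ∀ z xs ys → symmetric z (xs ++ ys) ≡ symmetric z xs ++ mirror ys
symmetric-++ false xs ys = mirror-++ xs ys
symmetric-++ true  xs ys = cong (0ℚ ∷_) (mirror-++ xs ys)

length-mirror : ∀ ys → length (mirror ys) ≡ length ys ℕ.+ length ys
length-mirror []       = refl
length-mirror (y ∷ ys) = cong suc (≡-trans (cong suc (length-mirror ys)) (sym (ℕ.+-suc _ _)))

symmetric-∷ : ∀ z x ys → x ∷ - x ∷ symmetric z ys ↭ symmetric z (x ∷ ys)
symmetric-∷ false x ys = refl
symmetric-∷ true  x ys = trans (prep x (swap (- x) 0ℚ refl)) (swap x 0ℚ refl)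

square-neg : ∀ y → square (- y) ≡ square y
square-neg = solve 1 (λ y → (:- y) :* (:- y) := y :* y) refl

cube-neg : ∀ y → cube (- y) ≡ - cube y
cube-neg = solve 1 (λ y → (:- y) :* (:- y) :* (:- y) := :- (y :* y :* y)) refl

sumOf-mirror-odd : ∀ g → (∀ y → g (- y) ≡ - g y) → ∀ ys → sumOf g (mirror ys) ≡ 0ℚ
sumOf-mirror-odd g odd []       = refl
sumOf-mirror-odd g odd (y ∷ ys) = begin
  g y + (g (- y) + sumOf g (mirror ys)) ≡⟨ cong₂ (λ u v → g y + (u + v)) (odd y) (sumOf-mirror-odd g odd ys) ⟩
  g y + (- g y + 0ℚ)                    ≡⟨ cong (λ u → g y + u) (+-identityʳ (- g y)) ⟩
  g y + - g y                           ≡⟨ +-inverseʳ (g y) ⟩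
  0ℚ                                    ∎
  where open ≡-Reasoning

sumOf-mirror-even : ∀ g → (∀ y → g (- y) ≡ g y) → ∀ ys → sumOf g (mirror ys) ≡ sumOf g ys + sumOf g ys
sumOf-mirror-even g even []       = refl
sumOf-mirror-even g even (y ∷ ys) = begin
  g y + (g (- y) + sumOf g (mirror ys)) ≡⟨ cong₂ (λ u v → g y + (u + v)) (even y) (sumOf-mirror-even g even ys) ⟩
  g y + (g y + (s + s))
    ≡⟨ solve 2 (λ a s → a :+ (a :+ (s :+ s)) := (a :+ s) :+ (a :+ s)) refl (g y) s ⟩
  (g y + s) + (g y + s)                 ∎
  where
  open ≡-Reasoning
  s = sumOf g ys

sumOf-square-symmetric : ∀ z ys → sumOf square (symmetric z ys) ≡ sumOf square ys + sumOf square ys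
sumOf-square-symmetric false ys = sumOf-mirror-even square square-neg ys
sumOf-square-symmetric true  ys = ≡-trans (+-identityˡ _) (sumOf-mirror-even square square-neg ys)

mirror-moments : ∀ ys → sumOf square ys ≡ fromℕ (length ys) * ½ → HasHermiteMoments (mirror ys)
mirror-moments ys s₂ =
  power-sums⇒moments {mirror ys} (sumOf-mirror-odd id (λ _ → refl) ys) second (sumOf-mirror-odd cube cube-neg ys)
  where
  open ≡-Reasoning
  k = fromℕ (length ys)
  second : sumOf square (mirror ys) ≡ fromℕ (length (mirror ys)) * ½
  second = begin
    sumOf square (mirror ys)              ≡⟨ sumOf-mirror-even square square-neg ys ⟩
    sumOf square ys + sumOf square ys     ≡⟨ cong₂ _+_ s₂ s₂ ⟩
    k * ½ + k * ½                         ≡⟨ *-distribʳ-+ ½ k k ⟨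
    (k + k) * ½                           ≡⟨ cong (_* ½) (fromℕ-+ (length ys) (length ys)) ⟨
    fromℕ (length ys ℕ.+ length ys) * ½   ≡⟨ cong (λ n → fromℕ n * ½) (length-mirror ys) ⟨
    fromℕ (length (mirror ys)) * ½        ∎

All-mirror : ∀ {P : ℚ → Set} {ys} → All P ys → All (P ∘ -_) ys → All P (mirror ys)
All-mirror []       []       = []
All-mirror (p ∷ ps) (q ∷ qs) = p ∷ q ∷ All-mirror ps qs

neg<pos : ∀ {x y} → 0ℚ < x → 0ℚ < y → - x < y
neg<pos 0<x 0<y = <-trans (neg-antimono-< 0<x) 0<y

mirror-unique : ∀ {ys} → All (0ℚ <_) ys → Unique ys → Unique (mirror ys)
mirror-unique []             []           = []
mirror-unique (0<y ∷ 0<ys) (y∉ys ∷ u) =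
  (≢-sym (<⇒≢ (neg<pos 0<y 0<y)) ∷ All-mirror y∉ys (All.map (λ 0<z → ≢-sym (<⇒≢ (neg<pos 0<z 0<y))) 0<ys))
  ∷ All-mirror (All.map (λ 0<z → <⇒≢ (neg<pos 0<y 0<z)) 0<ys) (All.map (λ y≢z → y≢z ∘ neg-injective) y∉ys)
  ∷ mirror-unique 0<ys u

symmetric-unique : ∀ z {ys} → All (0ℚ <_) ys → Unique ys → Unique (symmetric z ys)
symmetric-unique false 0<ys u = mirror-unique 0<ys u
symmetric-unique true  0<ys u =
  All-mirror (All.map <⇒≢ 0<ys) (All.map (λ 0<y → ≢-sym (<⇒≢ (neg-antimono-< 0<y))) 0<ys)
  ∷ mirror-unique 0<ys u

NegationClosed : List ℚ → Set
NegationClosed xs = ∀ x → x ∈ xs → - x ∈ xs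

mirror-closed : ∀ ys → NegationClosed (mirror ys)
mirror-closed (y ∷ ys) _ (here refl)         = there (here refl)
mirror-closed (y ∷ ys) _ (there (here refl)) = here (neg-involutive y)
mirror-closed (y ∷ ys) x (there (there x∈))  = there (there (mirror-closed ys x x∈))

symmetric-closed : ∀ z ys → NegationClosed (symmetric z ys)
symmetric-closed false ys                = mirror-closed ys
symmetric-closed true  ys _ (here refl)  = here refl
symmetric-closed true  ys x (there x∈)   = there (mirror-closed ys x x∈)

closed⇒antipodal : ∀ {xs} → NegationClosed xs → IsAntipodal xs
closed⇒antipodal {xs} closed = closed , λ x -x∈xs → subst (_∈ xs) (neg-involutive x) (closed (- x) -x∈xs)

-- Existence

Design : ℕ → Set
Design n = Σ (List ℚ) (λ xs → IsHermite3Design n xs × IsAntipodal xs)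

design : ∀ {xs} → Unique xs → HasHermiteMoments xs → NegationClosed xs → Design (length xs)
design {xs} u m closed = xs , (refl , u , m) , closed⇒antipodal closed

pythagorean : ∀ p q r → p ℕ.* p ℕ.+ q ℕ.* q ≡ suc r ℕ.* suc r →
  square (+ p / suc r) + square (+ q / suc r) ≡ 1ℚ
pythagorean p q r h = toℚᵘ-injective (begin-equality
  toℚᵘ (x * x + y * y)                        ≃⟨ toℚᵘ-homo-+ (x * x) (y * y) ⟩
  toℚᵘ (x * x) ℚᵘ.+ toℚᵘ (y * y)              ≃⟨ ℚᵘ.+-cong (toℚᵘ-homo-* x x) (toℚᵘ-homo-* y y) ⟩
  toℚᵘ x ℚᵘ.* toℚᵘ x ℚᵘ.+ toℚᵘ y ℚᵘ.* toℚᵘ y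
    ≃⟨ ℚᵘ.+-cong (ℚᵘ.*-cong x≃ x≃) (ℚᵘ.*-cong y≃ y≃) ⟩
  X ℚᵘ.* X ℚᵘ.+ Y ℚᵘ.* Y                      ≃⟨ ℚᵘ.*≡* cleared ⟩
  ℚᵘ.1ℚᵘ                                      ∎)
  where
  open ℚᵘ.≤-Reasoning
  x = + p / suc r
  y = + q / suc r
  X = ℚᵘ.mkℚᵘ (+ p) r
  Y = ℚᵘ.mkℚᵘ (+ q) r
  x≃ = toℚᵘ-fromℚᵘ X
  y≃ = toℚᵘ-fromℚᵘ Y
  R = + suc r
  hℤ : + p ℤ.* + p ℤ.+ + q ℤ.* + q ≡ R ℤ.* R
  hℤ = ≡-trans (sym (cong₂ ℤ._+_ (ℤ.pos-* p p) (ℤ.pos-* q q)))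
        (≡-trans (sym (ℤ.pos-+ (p ℕ.* p) (q ℕ.* q))) (≡-trans (cong +_ h) (ℤ.pos-* (suc r) (suc r))))
  cleared : (+ p ℤ.* + p ℤ.* (R ℤ.* R) ℤ.+ + q ℤ.* + q ℤ.* (R ℤ.* R)) ℤ.* + 1 ≡ + 1 ℤ.* (R ℤ.* R ℤ.* (R ℤ.* R))
  cleared = ≡-trans (ℤ.*-identityʳ _) (≡-trans (sym (ℤ.*-distribʳ-+ (R ℤ.* R) (+ p ℤ.* + p) (+ q ℤ.* + q)))
             (≡-trans (cong (ℤ._* (R ℤ.* R)) hℤ) (sym (ℤ.*-identityˡ (R ℤ.* R ℤ.* (R ℤ.* R))))))

strictly-monotone : ∀ {A : Set} (_R_ : A → A → Set) → Transitive _R_ →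
  (f : ℕ → A) → (∀ i → f i R f (suc i)) → ∀ {i j} → i ℕ.< j → f i R f j
strictly-monotone _R_ R-trans f step {i} {suc j} (s≤s i≤j) with ℕ.m≤n⇒m<n∨m≡n i≤j
... | inj₁ i<j  = R-trans (strictly-monotone _R_ R-trans f step i<j) (step j)
... | inj₂ refl = step i

-- (m² − 1, 2m, m² + 1) is a Pythagorean triple; m = 10 + t puts circleX above 49/50 and
-- circleY below 1/5, on either side of the gap that holds the cores.
leg : ℕ → ℕ
leg t = (9 ℕ.+ t) ℕ.* (11 ℕ.+ t)

circleX circleY : ℕ → ℚ
circleX t = + leg t / suc (suc (leg t))
circleY t = + (2 ℕ.* (10 ℕ.+ t)) / suc (suc (leg t))

circle : ∀ t → square (circleX t) + square (circleY t) ≡ 1ℚ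
circle t = pythagorean (leg t) (2 ℕ.* (10 ℕ.+ t)) (suc (leg t)) (triple t)
  where
  triple : ∀ t → (9 ℕ.+ t) ℕ.* (11 ℕ.+ t) ℕ.* ((9 ℕ.+ t) ℕ.* (11 ℕ.+ t))
                   ℕ.+ 2 ℕ.* (10 ℕ.+ t) ℕ.* (2 ℕ.* (10 ℕ.+ t))
               ≡ (2 ℕ.+ (9 ℕ.+ t) ℕ.* (11 ℕ.+ t)) ℕ.* (2 ℕ.+ (9 ℕ.+ t) ℕ.* (11 ℕ.+ t))
  triple = ℕ-Ring.solve-∀

circleY<⅕ : ∀ t → circleY t < + 1 / 5
circleY<⅕ t = fraction-< (2 ℕ.* (10 ℕ.+ t)) 1 (suc (leg t)) 4 (<-of-difference (t ℕ.* (10 ℕ.+ t)) (difference t))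
  where
  difference : ∀ t → 2 ℕ.* (10 ℕ.+ t) ℕ.* 5 ℕ.+ suc (t ℕ.* (10 ℕ.+ t))
                     ≡ 1 ℕ.* (2 ℕ.+ (9 ℕ.+ t) ℕ.* (11 ℕ.+ t))
  difference = ℕ-Ring.solve-∀

49/50<circleX : ∀ t → + 49 / 50 < circleX t
49/50<circleX t = fraction-< 49 (leg t) 49 (suc (leg t)) (<-of-difference (t ℕ.* t ℕ.+ 20 ℕ.* t) (difference t))
  where
  difference : ∀ t → 49 ℕ.* (2 ℕ.+ (9 ℕ.+ t) ℕ.* (11 ℕ.+ t)) ℕ.+ suc (t ℕ.* t ℕ.+ 20 ℕ.* t)
                     ≡ (9 ℕ.+ t) ℕ.* (11 ℕ.+ t) ℕ.* 50
  difference = ℕ-Ring.solve-∀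

0<circleY : ∀ t → 0ℚ < circleY t
0<circleY t = fraction-< 0 (2 ℕ.* (10 ℕ.+ t)) 0 (suc (leg t)) z<s

circleX-increasing : ∀ {i j} → i ℕ.< j → circleX i < circleX j
circleX-increasing = strictly-monotone _<_ <-trans circleX step
  where
  difference : ∀ t → (9 ℕ.+ t) ℕ.* (11 ℕ.+ t) ℕ.* (2 ℕ.+ (10 ℕ.+ t) ℕ.* (12 ℕ.+ t)) ℕ.+ suc (41 ℕ.+ 4 ℕ.* t)
            ≡ (10 ℕ.+ t) ℕ.* (12 ℕ.+ t) ℕ.* (2 ℕ.+ (9 ℕ.+ t) ℕ.* (11 ℕ.+ t))
  difference = ℕ-Ring.solve-∀
  step : ∀ t → circleX t < circleX (suc t)
  step t = fraction-< (leg t) (leg (suc t)) (suc (leg t)) (suc (leg (suc t)))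
    (<-of-difference (41 ℕ.+ 4 ℕ.* t) (difference t))

circleY-decreasing : ∀ {i j} → i ℕ.< j → circleY j < circleY i
circleY-decreasing = strictly-monotone (λ a b → b < a) (λ a>b b>c → <-trans b>c a>b) circleY step
  where
  difference : ∀ t → 2 ℕ.* (11 ℕ.+ t) ℕ.* (2 ℕ.+ (9 ℕ.+ t) ℕ.* (11 ℕ.+ t))
                       ℕ.+ suc (2 ℕ.* t ℕ.* t ℕ.+ 42 ℕ.* t ℕ.+ 217)
            ≡ 2 ℕ.* (10 ℕ.+ t) ℕ.* (2 ℕ.+ (10 ℕ.+ t) ℕ.* (12 ℕ.+ t))
  difference = ℕ-Ring.solve-∀
  step : ∀ t → circleY (suc t) < circleY t
  step t = fraction-< (2 ℕ.* (11 ℕ.+ t)) (2 ℕ.* (10 ℕ.+ t)) (suc (leg (suc t))) (suc (leg t))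
    (<-of-difference (2 ℕ.* t ℕ.* t ℕ.+ 42 ℕ.* t ℕ.+ 217) (difference t))

sumOf-square-on-circle : ∀ (f g : ℕ → ℚ) → (∀ i → square (f i) + square (g i) ≡ 1ℚ) →
  ∀ q → sumOf square (applyUpTo f q) + sumOf square (applyUpTo g q) ≡ fromℕ q
sumOf-square-on-circle f g on-circle zero    = refl
sumOf-square-on-circle f g on-circle (suc q) = begin
  (square (f 0) + A) + (square (g 0) + B)
    ≡⟨ solve 4 (λ a b c d → (a :+ c) :+ (b :+ d) := (a :+ b) :+ (c :+ d)) refl (square (f 0)) (square (g 0)) A B ⟩
  (square (f 0) + square (g 0)) + (A + B)
    ≡⟨ cong₂ _+_ (on-circle 0) (sumOf-square-on-circle (f ∘ suc) (g ∘ suc) (on-circle ∘ suc) q) ⟩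
  1ℚ + fromℕ q
    ≡⟨ fromℕ-+ 1 q ⟨
  fromℕ (suc q) ∎
  where
  open ≡-Reasoning
  A = sumOf square (applyUpTo (f ∘ suc) q)
  B = sumOf square (applyUpTo (g ∘ suc) q)

separated⇒disjoint : ∀ {P Q : ℚ → Set} {xs ys} → (∀ {x} → P x → Q x → ⊥) →
  All P xs → All Q ys → Disjoint xs ys
separated⇒disjoint separated pxs qys (x∈xs , x∈ys) = separated (All.lookup pxs x∈xs) (All.lookup qys x∈ys)

InGap : ℚ → Set
InGap c = + 1 / 5 < c × c < + 49 / 50

⅕<49/50 : + 1 / 5 < + 49 / 50
⅕<49/50 = from-yes (+ 1 / 5 <? + 49 / 50)

circlePoints : ℕ → List ℚ
circlePoints q = applyUpTo circleX q ++ applyUpTo circleY q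

length-circlePoints : ∀ q → length (circlePoints q) ≡ q ℕ.+ q
length-circlePoints q = ≡-trans (length-++ (applyUpTo circleX q))
  (cong₂ ℕ._+_ (length-applyUpTo circleX q) (length-applyUpTo circleY q))

circlePoints-moments : ∀ q → HasHermiteMoments (mirror (circlePoints q))
circlePoints-moments q = mirror-moments (circlePoints q) (begin
  sumOf square (applyUpTo circleX q ++ applyUpTo circleY q)
    ≡⟨ sumOf-++ square (applyUpTo circleX q) (applyUpTo circleY q) ⟩
  sumOf square (applyUpTo circleX q) + sumOf square (applyUpTo circleY q)
    ≡⟨ sumOf-square-on-circle circleX circleY circle q ⟩
  fromℕ q
    ≡⟨ solve 1 (λ k → k := (k :+ k) :* con ½) refl (fromℕ q) ⟩
  (fromℕ q + fromℕ q) * ½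
    ≡⟨ cong (_* ½) (fromℕ-+ q q) ⟨
  fromℕ (q ℕ.+ q) * ½
    ≡⟨ cong (λ n → fromℕ n * ½) (length-circlePoints q) ⟨
  fromℕ (length (circlePoints q)) * ½ ∎)
  where open ≡-Reasoning

circlePoints-outside-gap : ∀ q → All (λ x → + 49 / 50 < x ⊎ x < + 1 / 5) (circlePoints q)
circlePoints-outside-gap q = All.++⁺ (All.applyUpTo⁺₂ circleX q (inj₁ ∘ 49/50<circleX))
                                     (All.applyUpTo⁺₂ circleY q (inj₂ ∘ circleY<⅕))

circlePoints-positive : ∀ q → All (0ℚ <_) (circlePoints q)
circlePoints-positive q = All.++⁺
  (All.applyUpTo⁺₂ circleX q
    (λ t → <-trans (<-trans (0<circleY t) (circleY<⅕ t)) (<-trans ⅕<49/50 (49/50<circleX t))))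
  (All.applyUpTo⁺₂ circleY q 0<circleY)

circlePoints-unique : ∀ q → Unique (circlePoints q)
circlePoints-unique q = Unique.++⁺
  (Unique.applyUpTo⁺₁ circleX q (λ i<j _ → <⇒≢ (circleX-increasing i<j)))
  (Unique.applyUpTo⁺₁ circleY q (λ i<j _ → ≢-sym (<⇒≢ (circleY-decreasing i<j))))
  (separated⇒disjoint {λ x → + 49 / 50 < x} {_< + 1 / 5} (λ high low → <-asym (<-trans low ⅕<49/50) high)
    (All.applyUpTo⁺₂ circleX q 49/50<circleX) (All.applyUpTo⁺₂ circleY q circleY<⅕))

extend-core : ∀ z C → All InGap C → Unique C → HasHermiteMoments (symmetric z C) →
  ∀ q → Design (length (symmetric z C) ℕ.+ q ℕ.* 4)
extend-core z C C-in-gap C-unique C-moments q = subst Design size (design unique moments (symmetric-closed z ys))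
  where
  open ≡-Reasoning
  P = circlePoints q
  ys = C ++ P
  positive : All (0ℚ <_) ys
  positive = All.++⁺ (All.map (λ (⅕<c , _) → <-trans (from-yes (0ℚ <? + 1 / 5)) ⅕<c) C-in-gap)
                     (circlePoints-positive q)
  disjoint : Disjoint C P
  disjoint = separated⇒disjoint
    (λ { (⅕<c , c<49/50) (inj₁ 49/50<c) → <-asym c<49/50 49/50<c
       ; (⅕<c , c<49/50) (inj₂ c<⅕)     → <-asym c<⅕ ⅕<c })
    C-in-gap (circlePoints-outside-gap q)
  unique : Unique (symmetric z ys)
  unique = symmetric-unique z positive (Unique.++⁺ C-unique (circlePoints-unique q) disjoint)
  moments : HasHermiteMoments (symmetric z ys)
  moments = subst HasHermiteMoments (sym (symmetric-++ z C P))
              (moments-++ {symmetric z C} C-moments (circlePoints-moments q))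
  size : length (symmetric z ys) ≡ length (symmetric z C) ℕ.+ q ℕ.* 4
  size = begin
    length (symmetric z (C ++ P))                    ≡⟨ cong length (symmetric-++ z C P) ⟩
    length (symmetric z C ++ mirror P)               ≡⟨ length-++ (symmetric z C) ⟩
    length (symmetric z C) ℕ.+ length (mirror P)     ≡⟨ cong (length (symmetric z C) ℕ.+_) (length-mirror P) ⟩
    length (symmetric z C) ℕ.+ (length P ℕ.+ length P)
      ≡⟨ cong (λ n → length (symmetric z C) ℕ.+ (n ℕ.+ n)) (length-circlePoints q) ⟩
    length (symmetric z C) ℕ.+ ((q ℕ.+ q) ℕ.+ (q ℕ.+ q))
      ≡⟨ cong (length (symmetric z C) ℕ.+_) (four-times q) ⟩
    length (symmetric z C) ℕ.+ q ℕ.* 4               ∎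
    where
    four-times : ∀ q → (q ℕ.+ q) ℕ.+ (q ℕ.+ q) ≡ q ℕ.* 4
    four-times = ℕ-Ring.solve-∀

-- 19² + 22² = 5 · 13² and 5² + 10² + 13² = 6 · 7², so 0, ±core₅ and ±core₆ have second
-- moment n/2 for n = 5 and n = 6.
core₅ core₆ core₁₁ : List ℚ
core₅ = + 19 / 26 ∷ + 22 / 26 ∷ []
core₆ = + 5 / 14 ∷ + 10 / 14 ∷ + 13 / 14 ∷ []
core₁₁ = core₅ ++ core₆

in-gap? : ∀ c → Dec (InGap c)
in-gap? c = (+ 1 / 5 <? c) ×-dec (c <? + 49 / 50)

design-4q : ∀ q → Design (q ℕ.* 4)
design-4q = extend-core false [] [] [] (power-sums⇒moments {[]} refl refl refl)

design-5+4q : ∀ q → Design (5 ℕ.+ q ℕ.* 4)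
design-5+4q = extend-core true core₅ (from-yes (all? in-gap? core₅)) (from-yes (unique? _≟_ core₅))
  (power-sums⇒moments {symmetric true core₅} refl refl refl)

design-6+4q : ∀ q → Design (6 ℕ.+ q ℕ.* 4)
design-6+4q = extend-core false core₆ (from-yes (all? in-gap? core₆)) (from-yes (unique? _≟_ core₆))
  (power-sums⇒moments {symmetric false core₆} refl refl refl)

design-11+4q : ∀ q → Design (11 ℕ.+ q ℕ.* 4)
design-11+4q = extend-core true core₁₁ (from-yes (all? in-gap? core₁₁)) (from-yes (unique? _≟_ core₁₁))
  (power-sums⇒moments {symmetric true core₁₁} refl refl refl)

data Mod4 : ℕ → Set where
  rem0 : ∀ q → Mod4 (q ℕ.* 4)
  rem1 : ∀ q → Mod4 (1 ℕ.+ q ℕ.* 4)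
  rem2 : ∀ q → Mod4 (2 ℕ.+ q ℕ.* 4)
  rem3 : ∀ q → Mod4 (3 ℕ.+ q ℕ.* 4)

mod4 : ∀ n → Mod4 n
mod4 0 = rem0 0
mod4 1 = rem1 0
mod4 2 = rem2 0
mod4 3 = rem3 0
mod4 (suc (suc (suc (suc n)))) with mod4 n
... | rem0 q = rem0 (suc q)
... | rem1 q = rem1 (suc q)
... | rem2 q = rem2 (suc q)
... | rem3 q = rem3 (suc q)

Exceptional : ℕ → Set
Exceptional n = n ≡ 1 ⊎ n ≡ 2 ⊎ n ≡ 3 ⊎ n ≡ 7

design-exists : ∀ n → ¬ Exceptional n → Design n
design-exists n unexceptional with mod4 n
... | rem0 q             = design-4q q
... | rem1 zero          = ⊥-elim (unexceptional (inj₁ refl))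
... | rem1 (suc q)       = design-5+4q q
... | rem2 zero          = ⊥-elim (unexceptional (inj₂ (inj₁ refl)))
... | rem2 (suc q)       = design-6+4q q
... | rem3 zero          = ⊥-elim (unexceptional (inj₂ (inj₂ (inj₁ refl))))
... | rem3 (suc zero)    = ⊥-elim (unexceptional (inj₂ (inj₂ (inj₂ refl))))
... | rem3 (suc (suc q)) = design-11+4q q

-- Splitting an antipodal set

self-negative⇒0 : ∀ {x} → - x ≡ x → x ≡ 0ℚ
self-negative⇒0 {x} -x≡x =
  toℚᵘ-injective (ℚᵘ.p≃-p⇒p≃0 (toℚᵘ x) (ℚᵘ.≃-trans (toℚᵘ-cong (sym -x≡x)) (toℚᵘ-homo‿- x)))

neg-swap : ∀ {x y} → - x ≡ y → x ≡ - y
neg-swap {x} -x≡y = ≡-trans (sym (neg-involutive x)) (cong -_ -x≡y)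

unique-resp-↭ : ∀ {xs ys} → xs ↭ ys → Unique xs → Unique ys
unique-resp-↭ p = Unique-resp-↭ (setoid ℚ) (↭⇒↭ₛ p)

drop-zero : ∀ {xs} → Unique (0ℚ ∷ xs) → NegationClosed (0ℚ ∷ xs) → NegationClosed xs
drop-zero (0∉xs ∷ _) closed y y∈xs with closed y (there y∈xs)
... | here -y≡0    = ⊥-elim (All.lookup 0∉xs y∈xs (sym (neg-swap -y≡0)))
... | there -y∈xs = -y∈xs

drop-pair : ∀ {x xs} → x ≢ 0ℚ → Unique (x ∷ xs) → NegationClosed (x ∷ xs) →
  ∃ λ rest → xs ↭ - x ∷ rest × Unique rest × NegationClosed rest
drop-pair {x} x≢0 (x∉xs ∷ xs-unique) closed with closed x (here refl)
... | here -x≡x    = ⊥-elim (x≢0 (self-negative⇒0 -x≡x))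
... | there -x∈xs with ∈-∃++ -x∈xs
...   | us , vs , refl = us ++ vs , xs↭ , unique-rest , closed-rest
  where
  xs↭ : us ++ [ - x ] ++ vs ↭ - x ∷ us ++ vs
  xs↭ = shift (- x) us vs
  -x∉rest : All (- x ≢_) (us ++ vs)
  -x∉rest = AllPairs.head (unique-resp-↭ xs↭ xs-unique)
  unique-rest : Unique (us ++ vs)
  unique-rest = AllPairs.tail (unique-resp-↭ xs↭ xs-unique)
  closed-rest : NegationClosed (us ++ vs)
  closed-rest y y∈rest with closed y (there (∈-resp-↭ (↭-sym xs↭) (there y∈rest)))
  ... | here -y≡x = ⊥-elim (All.lookup -x∉rest y∈rest (sym (neg-swap -y≡x)))
  ... | there -y∈xs with ∈-resp-↭ xs↭ -y∈xs
  ...   | here -y≡-x =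
    ⊥-elim (All.lookup x∉xs (∈-resp-↭ (↭-sym xs↭) (there y∈rest)) (sym (neg-injective -y≡-x)))
  ...   | there -y∈rest = -y∈rest

antipodal-split : ∀ xs → Unique xs → NegationClosed xs → ∃₂ λ z ys → xs ↭ symmetric z ys
antipodal-split xs = split xs (<-wellFounded (length xs))
  where
  split : ∀ xs → Acc ℕ._<_ (length xs) → Unique xs → NegationClosed xs → ∃₂ λ z ys → xs ↭ symmetric z ys
  split []       _         _ _      = false , [] , refl
  split (x ∷ xs) (acc rec) u closed with x ≟ 0ℚ
  ... | yes refl with split xs (rec (ℕ.n<1+n _)) (AllPairs.tail u) (drop-zero u closed)
  ...   | false , ys , xs↭ = true , ys , prep 0ℚ xs↭
  ...   | true  , ys , xs↭ = ⊥-elim (All.lookup (AllPairs.head u) (∈-resp-↭ (↭-sym xs↭) (here refl)) refl)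
  split (x ∷ xs) (acc rec) u closed | no x≢0 with drop-pair x≢0 u closed
  ... | rest , xs↭ , rest-unique , rest-closed with split rest (rec shorter) rest-unique rest-closed
    where
    shorter : length rest ℕ.< length (x ∷ xs)
    shorter = s≤s (subst (length rest ℕ.≤_) (sym (↭-length xs↭)) (ℕ.n≤1+n _))
  ...   | z , ys , rest↭ = z , x ∷ ys , trans (prep x (trans xs↭ (prep (- x) rest↭))) (symmetric-∷ z x ys)

-- Seven is not a sum of three rational squares

data SquareMod8 (n : ℕ) : Set where
  even : ∀ h → n ≡ 2 ℕ.* h → SquareMod8 n
  odd  : ∀ k → n ℕ.* n ≡ 1 ℕ.+ 8 ℕ.* k → SquareMod8 n

square-mod-8 : ∀ n → SquareMod8 n
square-mod-8 n = by-residue (mod4 n)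
  where
  by-residue : ∀ {n} → Mod4 n → SquareMod8 n
  by-residue (rem0 q) = even (q ℕ.* 2) (square₀ q)
    where
    square₀ : ∀ q → q ℕ.* 4 ≡ 2 ℕ.* (q ℕ.* 2)
    square₀ = ℕ-Ring.solve-∀
  by-residue (rem1 q) = odd (2 ℕ.* q ℕ.* q ℕ.+ q) (square₁ q)
    where
    square₁ : ∀ q → (1 ℕ.+ q ℕ.* 4) ℕ.* (1 ℕ.+ q ℕ.* 4) ≡ 1 ℕ.+ 8 ℕ.* (2 ℕ.* q ℕ.* q ℕ.+ q)
    square₁ = ℕ-Ring.solve-∀
  by-residue (rem2 q) = even (1 ℕ.+ q ℕ.* 2) (square₂ q)
    where
    square₂ : ∀ q → 2 ℕ.+ q ℕ.* 4 ≡ 2 ℕ.* (1 ℕ.+ q ℕ.* 2)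
    square₂ = ℕ-Ring.solve-∀
  by-residue (rem3 q) = odd (1 ℕ.+ 3 ℕ.* q ℕ.+ 2 ℕ.* q ℕ.* q) (square₃ q)
    where
    square₃ : ∀ q → (3 ℕ.+ q ℕ.* 4) ℕ.* (3 ℕ.+ q ℕ.* 4) ≡ 1 ℕ.+ 8 ℕ.* (1 ℕ.+ 3 ℕ.* q ℕ.+ 2 ℕ.* q ℕ.* q)
    square₃ = ℕ-Ring.solve-∀

oddBit quarter : ∀ {n} → SquareMod8 n → ℕ
oddBit (even _ _) = 0
oddBit (odd _ _)  = 1
quarter (even h _) = h ℕ.* h
quarter (odd k _)  = 2 ℕ.* k

square-split : ∀ {n} (v : SquareMod8 n) → n ℕ.* n ≡ oddBit v ℕ.+ quarter v ℕ.* 4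
square-split (even h refl) = regroup h
  where
  regroup : ∀ h → 2 ℕ.* h ℕ.* (2 ℕ.* h) ≡ h ℕ.* h ℕ.* 4
  regroup = ℕ-Ring.solve-∀
square-split (odd k n²≡)   = ≡-trans n²≡ (cong suc (regroup k))
  where
  regroup : ∀ k → 8 ℕ.* k ≡ 2 ℕ.* k ℕ.* 4
  regroup = ℕ-Ring.solve-∀

oddBit≤1 : ∀ {n} (v : SquareMod8 n) → oddBit v ≤ 1
oddBit≤1 (even _ _) = z≤n
oddBit≤1 (odd _ _)  = s≤s z≤n

remainder-unique : ∀ d {r s} a b .{{_ : ℕ.NonZero d}} → r ℕ.< d → s ℕ.< d →
  r ℕ.+ a ℕ.* d ≡ s ℕ.+ b ℕ.* d → r ≡ s
remainder-unique d {r} {s} a b r<d s<d eq = begin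
  r                   ≡⟨ m<n⇒m%n≡m r<d ⟨
  r % d               ≡⟨ [m+kn]%n≡m%n r a d ⟨
  (r ℕ.+ a ℕ.* d) % d ≡⟨ cong (_% d) eq ⟩
  (s ℕ.+ b ℕ.* d) % d ≡⟨ [m+kn]%n≡m%n s b d ⟩
  s % d               ≡⟨ m<n⇒m%n≡m s<d ⟩
  s                   ∎
  where open ≡-Reasoning

odd-count : ∀ {x y z} (vx : SquareMod8 x) (vy : SquareMod8 y) (vz : SquareMod8 z) {r m} → r ℕ.< 4 →
  x ℕ.* x ℕ.+ y ℕ.* y ℕ.+ z ℕ.* z ≡ r ℕ.+ m ℕ.* 4 → oddBit vx ℕ.+ oddBit vy ℕ.+ oddBit vz ≡ r
odd-count vx vy vz {r} {m} r<4 eq = remainder-unique 4 (quarter vx ℕ.+ quarter vy ℕ.+ quarter vz) m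
  (s≤s (ℕ.+-mono-≤ (ℕ.+-mono-≤ (oddBit≤1 vx) (oddBit≤1 vy)) (oddBit≤1 vz))) r<4
  (≡-trans (sym (≡-trans (cong₂ ℕ._+_ (cong₂ ℕ._+_ (square-split vx) (square-split vy)) (square-split vz))
                         (regroup (oddBit vx) (oddBit vy) (oddBit vz) (quarter vx) (quarter vy) (quarter vz))))
           eq)
  where
  regroup : ∀ a b c p q r → a ℕ.+ p ℕ.* 4 ℕ.+ (b ℕ.+ q ℕ.* 4) ℕ.+ (c ℕ.+ r ℕ.* 4)
                            ≡ a ℕ.+ b ℕ.+ c ℕ.+ (p ℕ.+ q ℕ.+ r) ℕ.* 4
  regroup = ℕ-Ring.solve-∀

three-squares≢7-mod-8 : ∀ x y z k → x ℕ.* x ℕ.+ y ℕ.* y ℕ.+ z ℕ.* z ≢ 7 ℕ.+ k ℕ.* 8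
three-squares≢7-mod-8 x y z k eq = all-odd-impossible vx vy vz
  (odd-count vx vy vz {3} {1 ℕ.+ k ℕ.* 2} (s≤s (s≤s (s≤s (s≤s z≤n)))) (≡-trans eq (cong (3 ℕ.+_) (regroup k))))
  where
  vx = square-mod-8 x
  vy = square-mod-8 y
  vz = square-mod-8 z
  regroup : ∀ k → 4 ℕ.+ k ℕ.* 8 ≡ (1 ℕ.+ k ℕ.* 2) ℕ.* 4
  regroup = ℕ-Ring.solve-∀
  regroup₈ : ∀ a b c → 1 ℕ.+ 8 ℕ.* a ℕ.+ (1 ℕ.+ 8 ℕ.* b) ℕ.+ (1 ℕ.+ 8 ℕ.* c)
                       ≡ 3 ℕ.+ (a ℕ.+ b ℕ.+ c) ℕ.* 8
  regroup₈ = ℕ-Ring.solve-∀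
  all-odd-impossible : (vx : SquareMod8 x) (vy : SquareMod8 y) (vz : SquareMod8 z) →
    oddBit vx ℕ.+ oddBit vy ℕ.+ oddBit vz ≡ 3 → ⊥
  all-odd-impossible (odd a x²≡) (odd b y²≡) (odd c z²≡) _
    with remainder-unique 8 (a ℕ.+ b ℕ.+ c) k (s≤s (s≤s (s≤s (s≤s z≤n)))) ℕ.≤-refl
           (≡-trans (sym (≡-trans (cong₂ ℕ._+_ (cong₂ ℕ._+_ x²≡ y²≡) z²≡) (regroup₈ a b c))) eq)
  ... | ()
  all-odd-impossible (even _ _) (even _ _) (even _ _) ()
  all-odd-impossible (even _ _) (even _ _) (odd _ _)  ()
  all-odd-impossible (even _ _) (odd _ _)  (even _ _) ()
  all-odd-impossible (even _ _) (odd _ _)  (odd _ _)  ()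
  all-odd-impossible (odd _ _)  (even _ _) (even _ _) ()
  all-odd-impossible (odd _ _)  (even _ _) (odd _ _)  ()
  all-odd-impossible (odd _ _)  (odd _ _)  (even _ _) ()

three-squares-halve : ∀ x y z m → x ℕ.* x ℕ.+ y ℕ.* y ℕ.+ z ℕ.* z ≡ m ℕ.* 4 →
  ∃₂ λ a b → ∃ λ c → a ℕ.* a ℕ.+ b ℕ.* b ℕ.+ c ℕ.* c ≡ m
three-squares-halve x y z m eq = all-even (square-mod-8 x) (square-mod-8 y) (square-mod-8 z)
  (odd-count (square-mod-8 x) (square-mod-8 y) (square-mod-8 z) {0} {m} z<s eq)
  where
  quadruple : ∀ a b c → (a ℕ.* a ℕ.+ b ℕ.* b ℕ.+ c ℕ.* c) ℕ.* 4
                        ≡ 2 ℕ.* a ℕ.* (2 ℕ.* a) ℕ.+ 2 ℕ.* b ℕ.* (2 ℕ.* b) ℕ.+ 2 ℕ.* c ℕ.* (2 ℕ.* c)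
  quadruple = ℕ-Ring.solve-∀
  all-even : (vx : SquareMod8 x) (vy : SquareMod8 y) (vz : SquareMod8 z) →
    oddBit vx ℕ.+ oddBit vy ℕ.+ oddBit vz ≡ 0 →
    ∃₂ λ a b → ∃ λ c → a ℕ.* a ℕ.+ b ℕ.* b ℕ.+ c ℕ.* c ≡ m
  all-even (even a x≡2a) (even b y≡2b) (even c z≡2c) _ = a , b , c , ℕ.*-cancelʳ-≡ _ _ 4 (begin
    (a ℕ.* a ℕ.+ b ℕ.* b ℕ.+ c ℕ.* c) ℕ.* 4                        ≡⟨ quadruple a b c ⟩
    2 ℕ.* a ℕ.* (2 ℕ.* a) ℕ.+ 2 ℕ.* b ℕ.* (2 ℕ.* b) ℕ.+ 2 ℕ.* c ℕ.* (2 ℕ.* c)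
      ≡⟨ cong₂ ℕ._+_ (cong₂ ℕ._+_ (cong₂ ℕ._*_ x≡2a x≡2a) (cong₂ ℕ._*_ y≡2b y≡2b))
                     (cong₂ ℕ._*_ z≡2c z≡2c) ⟨
    x ℕ.* x ℕ.+ y ℕ.* y ℕ.+ z ℕ.* z                                ≡⟨ eq ⟩
    m ℕ.* 4                                                        ∎)
    where open ≡-Reasoning
  all-even (even _ _) (even _ _) (odd _ _)  ()
  all-even (even _ _) (odd _ _)  (even _ _) ()
  all-even (even _ _) (odd _ _)  (odd _ _)  ()
  all-even (odd _ _)  (even _ _) (even _ _) ()
  all-even (odd _ _)  (even _ _) (odd _ _)  ()
  all-even (odd _ _)  (odd _ _)  (even _ _) ()
  all-even (odd _ _)  (odd _ _)  (odd _ _)  ()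

three-squares≡7*square⇒0 : ∀ w x y z → x ℕ.* x ℕ.+ y ℕ.* y ℕ.+ z ℕ.* z ≡ 7 ℕ.* (w ℕ.* w) → w ≡ 0
three-squares≡7*square⇒0 = <-rec OnlyZero descent
  where
  spread : ∀ k → 7 ℕ.* (1 ℕ.+ 8 ℕ.* k) ≡ 7 ℕ.+ 7 ℕ.* k ℕ.* 8
  spread = ℕ-Ring.solve-∀
  quadruple : ∀ v → 7 ℕ.* (2 ℕ.* v ℕ.* (2 ℕ.* v)) ≡ 7 ℕ.* (v ℕ.* v) ℕ.* 4
  quadruple = ℕ-Ring.solve-∀
  OnlyZero : ℕ → Set
  OnlyZero w = ∀ x y z → x ℕ.* x ℕ.+ y ℕ.* y ℕ.+ z ℕ.* z ≡ 7 ℕ.* (w ℕ.* w) → w ≡ 0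
  descent : ∀ w → (∀ {v} → v ℕ.< w → OnlyZero v) → OnlyZero w
  descent w smaller x y z eq = by-parity (square-mod-8 w)
    where
    by-parity : SquareMod8 w → w ≡ 0
    by-parity (odd k w²≡) =
      ⊥-elim (three-squares≢7-mod-8 x y z (7 ℕ.* k) (≡-trans eq (≡-trans (cong (7 ℕ.*_) w²≡) (spread k))))
    by-parity (even zero w≡0) = w≡0
    by-parity (even (suc v) w≡2v) =
      let a , b , c , eq′ = three-squares-halve x y z (7 ℕ.* (suc v ℕ.* suc v))
                              (≡-trans eq (≡-trans (cong (λ u → 7 ℕ.* (u ℕ.* u)) w≡2v) (quadruple (suc v))))
      in ≡-trans w≡2v (cong (2 ℕ.*_) (smaller (subst (suc v ℕ.<_) (sym w≡2v) (ℕ.m<m+n (suc v) z<s)) a b c eq′))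

square-abs : ∀ i → i ℤ.* i ≡ + (∣ i ∣ ℕ.* ∣ i ∣)
square-abs (+ n)      = sym (ℤ.pos-* n n)
square-abs ℤ.-[1+ n ] = refl

three-squares≡7*square⇒0ℤ : ∀ X Y Z W → X ℤ.* X ℤ.+ Y ℤ.* Y ℤ.+ Z ℤ.* Z ≡ + 7 ℤ.* (W ℤ.* W) → W ≡ + 0
three-squares≡7*square⇒0ℤ X Y Z W eq =
  ℤ.∣i∣≡0⇒i≡0 (three-squares≡7*square⇒0 (∣ W ∣) (∣ X ∣) (∣ Y ∣) (∣ Z ∣) (ℤ.+-injective (begin
    + (∣ X ∣ ℕ.* ∣ X ∣ ℕ.+ ∣ Y ∣ ℕ.* ∣ Y ∣ ℕ.+ ∣ Z ∣ ℕ.* ∣ Z ∣)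
      ≡⟨ ≡-trans (ℤ.pos-+ _ (∣ Z ∣ ℕ.* ∣ Z ∣))
           (cong (ℤ._+ + (∣ Z ∣ ℕ.* ∣ Z ∣)) (ℤ.pos-+ (∣ X ∣ ℕ.* ∣ X ∣) (∣ Y ∣ ℕ.* ∣ Y ∣))) ⟩
    + (∣ X ∣ ℕ.* ∣ X ∣) ℤ.+ + (∣ Y ∣ ℕ.* ∣ Y ∣) ℤ.+ + (∣ Z ∣ ℕ.* ∣ Z ∣)
      ≡⟨ cong₂ ℤ._+_ (cong₂ ℤ._+_ (square-abs X) (square-abs Y)) (square-abs Z) ⟨
    X ℤ.* X ℤ.+ Y ℤ.* Y ℤ.+ Z ℤ.* Z
      ≡⟨ eq ⟩
    + 7 ℤ.* (W ℤ.* W)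
      ≡⟨ cong (+ 7 ℤ.*_) (square-abs W) ⟩
    + 7 ℤ.* + (∣ W ∣ ℕ.* ∣ W ∣)
      ≡⟨ ℤ.pos-* 7 (∣ W ∣ ℕ.* ∣ W ∣) ⟨
    + (7 ℕ.* (∣ W ∣ ℕ.* ∣ W ∣)) ∎)))
  where open ≡-Reasoning

-- Writing x = a/p, y = b/q, z = c/r, the equation in ℚᵘ unfolds to the integer identity
-- cleared, i.e. (aqr)² + (bpr)² + (cpq)² = 7 (pqr)².
three-squares≢7 : ∀ x y z → x * x + y * y + z * z ≢ fromℕ 7
three-squares≢7 x@record{} y@record{} z@record{} eq = denominators≢0
  (three-squares≡7*square⇒0ℤ (↥ x ℤ.* ↧ y ℤ.* ↧ z) (↥ y ℤ.* ↧ x ℤ.* ↧ z) (↥ z ℤ.* ↧ x ℤ.* ↧ y)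
    (↧ x ℤ.* ↧ y ℤ.* ↧ z)
    (≡-trans (spread (↥ x) (↥ y) (↥ z) (↧ x) (↧ y) (↧ z)) (≡-trans cleared (collect (↧ x) (↧ y) (↧ z)))))
  where
  denominators≢0 : ↧ x ℤ.* ↧ y ℤ.* ↧ z ≢ + 0
  denominators≢0 ()
  cleared : ((↥ x ℤ.* ↥ x) ℤ.* (↧ y ℤ.* ↧ y) ℤ.+ (↥ y ℤ.* ↥ y) ℤ.* (↧ x ℤ.* ↧ x))
              ℤ.* (↧ z ℤ.* ↧ z)
              ℤ.+ (↥ z ℤ.* ↥ z) ℤ.* ((↧ x ℤ.* ↧ x) ℤ.* (↧ y ℤ.* ↧ y))
            ≡ + 7 ℤ.* (((↧ x ℤ.* ↧ x) ℤ.* (↧ y ℤ.* ↧ y)) ℤ.* (↧ z ℤ.* ↧ z))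
  cleared = ≡-trans (sym (ℤ.*-identityʳ _)) (ℚᵘ.drop-*≡* (begin-equality
    toℚᵘ x ℚᵘ.* toℚᵘ x ℚᵘ.+ toℚᵘ y ℚᵘ.* toℚᵘ y ℚᵘ.+ toℚᵘ z ℚᵘ.* toℚᵘ z
      ≃⟨ ℚᵘ.+-cong (ℚᵘ.+-cong (toℚᵘ-homo-* x x) (toℚᵘ-homo-* y y)) (toℚᵘ-homo-* z z) ⟨
    toℚᵘ (x * x) ℚᵘ.+ toℚᵘ (y * y) ℚᵘ.+ toℚᵘ (z * z)
      ≃⟨ ℚᵘ.+-cong (toℚᵘ-homo-+ (x * x) (y * y)) ℚᵘ.≃-refl ⟨
    toℚᵘ (x * x + y * y) ℚᵘ.+ toℚᵘ (z * z)
      ≃⟨ toℚᵘ-homo-+ (x * x + y * y) (z * z) ⟨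
    toℚᵘ (x * x + y * y + z * z)
      ≃⟨ toℚᵘ-cong eq ⟩
    toℚᵘ (fromℕ 7) ∎))
    where open ℚᵘ.≤-Reasoning
  spread : ∀ a b c p q r →
    (a ℤ.* q ℤ.* r) ℤ.* (a ℤ.* q ℤ.* r) ℤ.+ (b ℤ.* p ℤ.* r) ℤ.* (b ℤ.* p ℤ.* r)
      ℤ.+ (c ℤ.* p ℤ.* q) ℤ.* (c ℤ.* p ℤ.* q)
    ≡ ((a ℤ.* a) ℤ.* (q ℤ.* q) ℤ.+ (b ℤ.* b) ℤ.* (p ℤ.* p)) ℤ.* (r ℤ.* r)
      ℤ.+ (c ℤ.* c) ℤ.* ((p ℤ.* p) ℤ.* (q ℤ.* q))
  spread = ℤ-Ring.solve-∀
  collect : ∀ p q r → + 7 ℤ.* (((p ℤ.* p) ℤ.* (q ℤ.* q)) ℤ.* (r ℤ.* r))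
                    ≡ + 7 ℤ.* ((p ℤ.* q ℤ.* r) ℤ.* (p ℤ.* q ℤ.* r))
  collect = ℤ-Ring.solve-∀

square≢2 : ∀ x → x * x ≢ fromℕ 2
square≢2 x eq = three-squares≢7 x 1ℚ (fromℕ 2) (cong (λ s → s + 1ℚ * 1ℚ + fromℕ 2 * fromℕ 2) eq)

square≢3 : ∀ x → x * x ≢ fromℕ 3
square≢3 x eq = three-squares≢7 x (fromℕ 2) 0ℚ (cong (λ s → s + fromℕ 2 * fromℕ 2 + 0ℚ * 0ℚ) eq)

-- Non-existence

double : ℚ → ℚ
double y = y + y

sumOf-square-double : ∀ ys → sumOf square (map double ys)
  ≡ (sumOf square ys + sumOf square ys) + (sumOf square ys + sumOf square ys)
sumOf-square-double []       = refl
sumOf-square-double (y ∷ ys) = begin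
  square (y + y) + sumOf square (map double ys)   ≡⟨ cong (λ t → square (y + y) + t) (sumOf-square-double ys) ⟩
  square (y + y) + ((s + s) + (s + s))
    ≡⟨ solve 2 (λ y s → (y :+ y) :* (y :+ y) :+ ((s :+ s) :+ (s :+ s))
                        := ((y :* y :+ s) :+ (y :* y :+ s)) :+ ((y :* y :+ s) :+ (y :* y :+ s))) refl y s ⟩
  (square y + s + (square y + s)) + (square y + s + (square y + s)) ∎
  where
  open ≡-Reasoning
  s = sumOf square ys

second-moment⇒doubled-squares : ∀ z ys {n} → sumOf square (symmetric z ys) ≡ fromℕ n * ½ →
  sumOf square (map double ys) ≡ fromℕ n
second-moment⇒doubled-squares z ys {n} eq = begin
  sumOf square (map double ys)                        ≡⟨ sumOf-square-double ys ⟩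
  (s + s) + (s + s)                                   ≡⟨ cong (λ t → t + t) (sumOf-square-symmetric z ys) ⟨
  sumOf square (symmetric z ys) + sumOf square (symmetric z ys) ≡⟨ cong (λ t → t + t) eq ⟩
  fromℕ n * ½ + fromℕ n * ½
    ≡⟨ solve 1 (λ k → k :* con ½ :+ k :* con ½ := k) refl (fromℕ n) ⟩
  fromℕ n                                             ∎
  where
  open ≡-Reasoning
  s = sumOf square ys

exceptional? : ∀ n → Dec (Exceptional n)
exceptional? n = n ℕ.≟ 1 ⊎-dec n ℕ.≟ 2 ⊎-dec n ℕ.≟ 3 ⊎-dec n ℕ.≟ 7

doubled-squares⇒unexceptional : ∀ z ys → sumOf square (map double ys) ≡ fromℕ (length (symmetric z ys)) →
  ¬ Exceptional (length (symmetric z ys))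
doubled-squares⇒unexceptional true  []                 ()
doubled-squares⇒unexceptional false (a ∷ [])           eq _ = square≢2 (a + a) (≡-trans (sym (+-identityʳ _)) eq)
doubled-squares⇒unexceptional true  (a ∷ [])           eq _ = square≢3 (a + a) (≡-trans (sym (+-identityʳ _)) eq)
doubled-squares⇒unexceptional true  (a ∷ b ∷ c ∷ [])   eq _ = three-squares≢7 (a + a) (b + b) (c + c) (≡-trans
  (solve 3 (λ p q r → p :+ q :+ r := p :+ (q :+ (r :+ con 0ℚ))) refl
     (square (a + a)) (square (b + b)) (square (c + c))) eq)
doubled-squares⇒unexceptional false []                  _ = from-no (exceptional? 0)
doubled-squares⇒unexceptional false (a ∷ b ∷ [])        _ = from-no (exceptional? 4)
doubled-squares⇒unexceptional true  (a ∷ b ∷ [])        _ = from-no (exceptional? 5)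
doubled-squares⇒unexceptional false (a ∷ b ∷ c ∷ [])    _ = from-no (exceptional? 6)
doubled-squares⇒unexceptional false (a ∷ b ∷ c ∷ d ∷ ys) _ = from-no (exceptional? (8 ℕ.+ length (mirror ys)))
doubled-squares⇒unexceptional true  (a ∷ b ∷ c ∷ d ∷ ys) _ = from-no (exceptional? (9 ℕ.+ length (mirror ys)))

no-exceptional-design : ∀ {n} → Design n → ¬ Exceptional n
no-exceptional-design {n} (xs , xs-design@(xs-length , xs-unique , _) , closed , _)
  with antipodal-split xs xs-unique closed
... | z , ys , xs↭ =
  doubled-squares⇒unexceptional z ys (second-moment⇒doubled-squares z ys {length (symmetric z ys)} second)
  ∘ subst Exceptional n≡
  where
  n≡ : n ≡ length (symmetric z ys)
  n≡ = ≡-trans (sym xs-length) (↭-length xs↭)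
  second : sumOf square (symmetric z ys) ≡ fromℕ (length (symmetric z ys)) * ½
  second = ≡-trans (sumOf-↭ square (↭-sym xs↭)) (≡-trans (second-moment xs-design) (cong (λ k → fromℕ k * ½) n≡))

theorem1p1 : (n : ℕ) → 1 ≤ n →
  (Σ (List ℚ) (λ xs → IsHermite3Design n xs × IsAntipodal xs))
    ⇔ (¬ (n ≡ 1 ⊎ n ≡ 2 ⊎ n ≡ 3 ⊎ n ≡ 7))
theorem1p1 n _ = mk⇔ no-exceptional-design (design-exists n)
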